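{- Let $M=(E,r)$ be a $q$-matroid and let $X\le E$ be cyclically closed, i.e. $\mathrm{cyc}(X)=X$. Then $\mathrm{cl}(X)$ is a cyclic flat of $M$.
   Context: Let $q$ be a prime power and $E$ an $n$-dimensional $\mathbb{F}_q$-vector space. A $q$-matroid $(E,r)$ is a function $r$ from subspaces of $E$ to $\mathbb{Z}$ with (R1) $0\le r(A)\le\dim A$, (R2) $r(A)\le r(B)$ if $A\le B$, (R3) $r(A+B)+r(A\cap B)\le r(A)+r(B)$. $\mathrm{cl}(A)=\sum x$ over all $1$-dimensional $x\le E$ with $r(A+x)=r(A)$. $\mathrm{cyc}(A)=\sum x$ over all $1$-dimensional $x\le A$ with $r(B+x)=r(B)$ for every subspace $B\le A$ of codimension $1$ in $A$. A flat is a subspace $F$ with $r(F+x)>r(F)$ for all $1$-dimensional $x\not\le F$; a subspace $A$ is cyclic if $r(B)=r(A)$ for every $B\le A$ of codimension $1$ in $A$; a cyclic flat is a subspace that is both cyclic and a flat. -}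

module Defs where

open import Level using (Level; _⊔_; suc) renaming (zero to lzero)
open import Data.Nat using (ℕ; _≤_; _<_) renaming (suc to sucℕ)
open import Data.Fin using (Fin)
import Data.Fin as Fin
open import Data.Product using (Σ; ∃; _×_; _,_; proj₁; proj₂)
open import Data.Sum using (_⊎_; inj₁; inj₂)
open import Data.List using (List; []; _∷_; _++_; map)
open import Data.List.Relation.Unary.All as All using (All; []; _∷_)
open import Data.List.Relation.Unary.All.Properties using (++⁺)
open import Data.List.Membership.Propositional using (_∈_)
open import Relation.Nullary using (¬_)
open import Relation.Binary.PropositionalEquality
open import Algebra.Structures using (IsCommutativeRing)

record FiniteField : Set₁ where
  infixl 6 _+_
  infixl 7 _*_
  field
    Carrier  : Set
    _+_ _*_  : Carrier → Carrier → Carrier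
    -_       : Carrier → Carrier
    0# 1#    : Carrier
    isCommutativeRing : IsCommutativeRing _≡_ _+_ _*_ -_ 0# 1#
    0≢1      : ¬ (0# ≡ 1#)
    inverse  : ∀ x → ¬ (x ≡ 0#) → Σ Carrier (λ y → x * y ≡ 1#)
    elements : List Carrier
    complete : ∀ x → x ∈ elements
  open IsCommutativeRing isCommutativeRing public

module QMat (𝔽 : FiniteField) (n : ℕ) where
  open FiniteField 𝔽 using (_+_; _*_; 0#; +-identityˡ; +-assoc; zeroʳ; distribˡ; *-assoc) renaming (Carrier to F)

  V : Set
  V = Fin n → F

  _≈ᵥ_ : V → V → Set
  u ≈ᵥ v = ∀ i → u i ≡ v i

  0ᵥ : V
  0ᵥ _ = 0#

  _+ᵥ_ : V → V → V
  (u +ᵥ v) i = u i + v i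

  _·ᵥ_ : F → V → V
  (c ·ᵥ v) i = c * v i

  eval : List (F × V) → V
  eval []             = 0ᵥ
  eval ((c , w) ∷ cs) = (c ·ᵥ w) +ᵥ eval cs

  record Subspace (ℓ : Level) : Set (suc ℓ) where
    field
      mem      : V → Set ℓ
      mem-resp : ∀ {u v} → u ≈ᵥ v → mem u → mem v
      mem-0    : mem 0ᵥ
      mem-+    : ∀ {u v} → mem u → mem v → mem (u +ᵥ v)
      mem-·    : ∀ c {v} → mem v → mem (c ·ᵥ v)
  open Subspace public

  _⊆_ : ∀ {ℓ ℓ'} → Subspace ℓ → Subspace ℓ' → Set (ℓ ⊔ ℓ')
  A ⊆ B = ∀ v → mem A v → mem B v

  _≐_ : ∀ {ℓ ℓ'} → Subspace ℓ → Subspace ℓ' → Set (ℓ ⊔ ℓ')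
  A ≐ B = (A ⊆ B) × (B ⊆ A)

  spanMem : ∀ {ℓ} → (V → Set ℓ) → V → Set ℓ
  spanMem P v = Σ (List (F × V)) λ cs → All (λ p → P (proj₂ p)) cs × (v ≈ᵥ eval cs)

  private
    ≈-trans : ∀ {u v w} → u ≈ᵥ v → v ≈ᵥ w → u ≈ᵥ w
    ≈-trans p q i = trans (p i) (q i)

    eval-++ : ∀ cs ds → (eval cs +ᵥ eval ds) ≈ᵥ eval (cs ++ ds)
    eval-++ [] ds i = +-identityˡ (eval ds i)
    eval-++ ((c , w) ∷ cs) ds i =
      trans (+-assoc (c * w i) (eval cs i) (eval ds i))
            (cong (c * w i +_) (eval-++ cs ds i))

    scale : F → F × V → F × V
    scale a (c , w) = (a * c , w)

    eval-map : ∀ a cs → (a ·ᵥ eval cs) ≈ᵥ eval (map (scale a) cs)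
    eval-map a [] i = zeroʳ a
    eval-map a ((c , w) ∷ cs) i =
      trans (distribˡ a (c * w i) (eval cs i))
            (cong₂ _+_ (sym (*-assoc a c (w i))) (eval-map a cs i))

    all-map : ∀ {ℓ} {P : V → Set ℓ} a cs →
              All (λ p → P (proj₂ p)) cs → All (λ p → P (proj₂ p)) (map (scale a) cs)
    all-map a [] [] = []
    all-map a (_ ∷ cs) (px ∷ pxs) = px ∷ all-map a cs pxs

  span : ∀ {ℓ} → (V → Set ℓ) → Subspace ℓ
  span P = record
    { mem      = spanMem P
    ; mem-resp = λ { u≈v (cs , a , u≈) → cs , a , (λ i → trans (sym (u≈v i)) (u≈ i)) }
    ; mem-0    = [] , [] , (λ i → refl)
    ; mem-+    = λ { (cs , a , p) (ds , b , q) →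
                     cs ++ ds , ++⁺ a b ,
                     ≈-trans (λ i → cong₂ _+_ (p i) (q i)) (eval-++ cs ds) }
    ; mem-·    = λ { c (cs , a , p) →
                     map (scale c) cs , all-map c cs a ,
                     ≈-trans (λ i → cong (c *_) (p i)) (eval-map c cs) }
    }

  _⊕_ : ∀ {ℓ} → Subspace ℓ → Subspace ℓ → Subspace ℓ
  A ⊕ B = span (λ v → mem A v ⊎ mem B v)

  _∩_ : ∀ {ℓ} → Subspace ℓ → Subspace ℓ → Subspace ℓ
  A ∩ B = record
    { mem      = λ v → mem A v × mem B v
    ; mem-resp = λ p (a , b) → mem-resp A p a , mem-resp B p b
    ; mem-0    = mem-0 A , mem-0 B
    ; mem-+    = λ (a , b) (a' , b') → mem-+ A a a' , mem-+ B b b'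
    ; mem-·    = λ c (a , b) → mem-· A c a , mem-· B c b
    }

  ⟨_⟩ : V → Subspace lzero
  ⟨ u ⟩ = span (λ v → v ≡ u)

  lc : ∀ {k} → (Fin k → F) → (Fin k → V) → V
  lc {Data.Nat.zero}   c b = 0ᵥ
  lc {sucℕ k} c b = (c Fin.zero ·ᵥ b Fin.zero) +ᵥ lc (λ i → c (Fin.suc i)) (λ i → b (Fin.suc i))

  HasDim : ∀ {ℓ} → Subspace ℓ → ℕ → Set ℓ
  HasDim A k = Σ (Fin k → V) λ b →
      (∀ i → mem A (b i))
    × (∀ (c : Fin k → F) → lc c b ≈ᵥ 0ᵥ → ∀ i → c i ≡ 0#)
    × (∀ v → mem A v → Σ (Fin k → F) λ c → v ≈ᵥ lc c b)

  Codim1 : ∀ {ℓ} → Subspace ℓ → Subspace ℓ → Set ℓ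
  Codim1 B A = (B ⊆ A) × Σ ℕ λ k → HasDim B k × HasDim A (sucℕ k)

  -- q-matroids on E = F^n.  Subspaces are represented as predicates, so
  -- r is required to be invariant under equality of subspaces.
  record QMatroid : Set₁ where
    field
      r      : Subspace lzero → ℕ
      r-resp : ∀ {A B} → A ≐ B → r A ≡ r B
      R1     : ∀ A k → HasDim A k → r A ≤ k
      R2     : ∀ {A B} → A ⊆ B → r A ≤ r B
      R3     : ∀ A B → r (A ⊕ B) Data.Nat.+ r (A ∩ B) ≤ r A Data.Nat.+ r B

  module _ (M : QMatroid) where
    open QMatroid M

    -- cl(A) = Σ { x : dim x = 1, r(A + x) = r(A) }, a 1-dimensional x
    -- being written ⟨u⟩ with u ≠ 0.
    cl : Subspace lzero → Subspace lzero
    cl A = span (λ u → ¬ (u ≈ᵥ 0ᵥ) × r (A ⊕ ⟨ u ⟩) ≡ r A)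

    cyc : Subspace lzero → Subspace (suc lzero)
    cyc A = span (λ v → Σ (Subspace lzero) λ x →
                    HasDim x 1 × x ⊆ A × mem x v ×
                    (∀ B → Codim1 B A → r (B ⊕ x) ≡ r B))

    CyclicallyClosed : Subspace lzero → Set₁
    CyclicallyClosed A = cyc A ≐ A

    IsFlat : Subspace lzero → Set₁
    IsFlat A = ∀ x → HasDim x 1 → ¬ (x ⊆ A) → r A < r (A ⊕ x)

    IsCyclic : Subspace lzero → Set₁
    IsCyclic A = ∀ B → Codim1 B A → r B ≡ r A

    IsCyclicFlat : Subspace lzero → Set₁
    IsCyclicFlat A = IsCyclic A × IsFlat A

-- Write C = cl X.  The basic rank fact is r (cl A) ≤ r B whenever A ≤ B: by submodularity a
-- vector u with r (A + ⟨u⟩) = r A does not raise the rank of any B ≥ A, and cl A is spanned by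
-- finitely many such vectors.
-- C is a flat: if a line x = ⟨u⟩ ⊄ C had r (C + x) = r C, then r (X + ⟨u⟩) ≤ r (C + x) = r C ≤ r X,
-- so u would be one of the vectors spanning C.
-- C is cyclic: let B be a hyperplane of C.  If X ≤ B then r C ≤ r B.  Otherwise, as X = cyc X, one
-- of the lines ℓ ≤ X generating cyc X is not contained in B; then B ∩ X is a hyperplane of X and
-- X ≤ (B ∩ X) + ℓ, so r X = r (B ∩ X) by the defining property of ℓ.  Submodularity now gives
-- r (B + X) ≤ r B, hence r C ≤ r (B + X) ≤ r B.

module Submission where

open import Level using (0ℓ)
open import Data.Nat as ℕ using (ℕ; zero; suc; _≤_; z≤n; s≤s)
import Data.Nat.Properties as ℕ
open import Data.Fin using (Fin; punchIn) renaming (zero to fz; suc to fs)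
import Data.Fin.Properties as Fin
open import Data.Vec.Functional using (tail; insertAt; removeAt) renaming (_∷_ to _∷ᶠ_)
open import Data.Vec.Functional.Properties using (insertAt-lookup; insertAt-punchIn)
open import Data.Product using (Σ; ∃; _×_; _,_; proj₁; proj₂)
open import Data.Sum using (inj₁; inj₂)
open import Data.Empty using (⊥-elim)
open import Data.List using (List; []; _∷_; filter; cartesianProductWith)
open import Data.List.Relation.Unary.All as All using (All; []; _∷_)
open import Data.List.Relation.Unary.All.Properties using (all-filter)
open import Data.List.Relation.Unary.Any using (Any; here; there; any?)
import Data.List.Membership.Setoid as SetoidMembership
open import Data.List.Membership.Setoid.Properties using (∈-cartesianProductWith⁺; ∈-resp-≈)
open import Data.List.Membership.Propositional using (_∈_; find)
open import Data.List.Membership.Propositional.Properties using (∈-filter⁺)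
open import Data.List.Relation.Unary.Enumerates.Setoid using (IsEnumeration)
open import Relation.Nullary using (¬_; Dec; yes; no; ¬?; _×-dec_)
open import Relation.Nullary.Negation using (DoubleNegation; ¬¬-Monad; ¬¬-map)
open import Relation.Nullary.Decidable using (decidable-stable; ¬¬-excluded-middle; map′)
open import Relation.Unary using (Pred; Decidable)
open import Relation.Binary using (Setoid; DecidableEquality)
open import Relation.Binary.PropositionalEquality
  using (_≡_; refl; sym; trans; cong; cong₂; subst; _≗_; setoid; _→-setoid_; module ≡-Reasoning)
open import Effect.Monad using (RawMonad)
open import Algebra.Bundles using (CommutativeRing)
open import Function using (_∘_)
open import Defs

module _ {a ℓ} (S : Setoid a ℓ) {xs : List (Setoid.Carrier S)} (enum : IsEnumeration S xs) where
  open Setoid S renaming (Carrier to A)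
  open SetoidMembership S using (lose)

  ∃?-enumerated : ∀ {p} {P : Pred A p} → (∀ {x y} → x ≈ y → P x → P y) → Decidable P → Dec (∃ P)
  ∃?-enumerated {P = P} resp P? = map′ witness (λ (x , px) → lose resp (enum x) px) (any? P? xs)
    where
    witness : Any P xs → ∃ P
    witness any with SetoidMembership.find S any
    ... | (x , _ , px) = x , px

  ¬¬-∀-enumerated : {P : Pred A a} → (∀ {x y} → x ≈ y → P x → P y) →
                    (∀ x → DoubleNegation (P x)) → DoubleNegation (∀ x → P x)
  ¬¬-∀-enumerated resp ¬¬P =
    ¬¬-map (λ all x → All.lookupₛ S resp all (enum x))
           (All.sequenceM 0ℓ ¬¬-Monad (All.tabulateₛ S (λ {x} _ → ¬¬P x)))

module _ (𝔽 : FiniteField) where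
  open FiniteField 𝔽
    using (_+_; _*_; -_; 0#; 1#; isCommutativeRing; 0≢1; inverse; elements; complete)
    renaming (Carrier to F)

  allFunctions : ∀ k → List (Fin k → F)
  allFunctions zero    = (λ ()) ∷ []
  allFunctions (suc k) = cartesianProductWith _∷ᶠ_ elements (allFunctions k)

  allFunctions-complete : ∀ k → IsEnumeration (Fin k →-setoid F) (allFunctions k)
  allFunctions-complete zero    f = here (λ ())
  allFunctions-complete (suc k) f =
    ∈-resp-≈ (Fin (suc k) →-setoid F) (λ { fz → refl ; (fs i) → refl })
      (∈-cartesianProductWith⁺ (setoid F) (Fin k →-setoid F) (Fin (suc k) →-setoid F) ∷-cong
        (complete (f fz)) (allFunctions-complete k (tail f)))
    where
    ∷-cong : ∀ {a b} {u v : Fin k → F} → a ≡ b → u ≗ v → (a ∷ᶠ u) ≗ (b ∷ᶠ v)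
    ∷-cong a≡b u≗v fz     = a≡b
    ∷-cong a≡b u≗v (fs i) = u≗v i

  ¬¬-decidableEquality : DoubleNegation (DecidableEquality F)
  ¬¬-decidableEquality = ¬¬-∀-enumerated (setoid F) complete (λ { refl d → d })
    (λ _ → ¬¬-∀-enumerated (setoid F) complete (λ { refl d → d }) (λ _ → ¬¬-excluded-middle))

  private
    ring : CommutativeRing 0ℓ 0ℓ
    ring = record { isCommutativeRing = isCommutativeRing }
    open CommutativeRing ring
      using ( +-group; +-abelianGroup; +-assoc; +-comm; +-identityˡ; +-identityʳ; -‿inverseʳ
            ; *-identityˡ; *-identityʳ; *-comm; *-assoc; zeroˡ; zeroʳ; distribˡ; distribʳ)
    open import Algebra.Properties.Ring (CommutativeRing.ring ring) using (-‿distribˡ-*; -‿distribʳ-*)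
    open import Algebra.Properties.Group +-group using (inverseʳ-unique; ⁻¹-involutive)
    open import Algebra.Properties.AbelianGroup +-abelianGroup using (xyx⁻¹≈y)
    open import Algebra.Properties.Semiring.Sum (CommutativeRing.semiring ring)
      using (sum; sum-cong-≗; ∑-distrib-+; *-distribˡ-sum; *-distribʳ-sum; sum-remove; sum-replicate-zero)

  solve-for : ∀ {a a⁻¹ y s} → a * a⁻¹ ≡ 1# → a * y + s ≡ 0# → y ≡ (- a⁻¹) * s
  solve-for {a} {a⁻¹} {y} {s} inv eq = begin
    y                      ≡⟨ sym (*-identityˡ y) ⟩
    1# * y                 ≡⟨ cong (_* y) (trans (sym inv) (*-comm a a⁻¹)) ⟩
    (a⁻¹ * a) * y          ≡⟨ *-assoc a⁻¹ a y ⟩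
    a⁻¹ * (a * y)          ≡⟨ sym (⁻¹-involutive _) ⟩
    - (- (a⁻¹ * (a * y)))  ≡⟨ cong -_ (-‿distribˡ-* a⁻¹ (a * y)) ⟩
    - ((- a⁻¹) * (a * y))  ≡⟨ -‿distribʳ-* (- a⁻¹) (a * y) ⟩
    (- a⁻¹) * (- (a * y))  ≡⟨ cong ((- a⁻¹) *_) (sym (inverseʳ-unique (a * y) s eq)) ⟩
    (- a⁻¹) * s            ∎
    where open ≡-Reasoning

  pivot-cancel : ∀ {a b b⁻¹} → b * b⁻¹ ≡ 1# → a + (- (a * b⁻¹)) * b ≡ 0#
  pivot-cancel {a} {b} {b⁻¹} inv = begin
    a + (- (a * b⁻¹)) * b  ≡⟨ cong (a +_) (sym (-‿distribˡ-* (a * b⁻¹) b)) ⟩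
    a + - ((a * b⁻¹) * b)  ≡⟨ cong (λ t → a + - t) (trans (*-assoc a b⁻¹ b) (cong (a *_) (*-comm b⁻¹ b))) ⟩
    a + - (a * (b * b⁻¹))  ≡⟨ cong (λ t → a + - (a * t)) inv ⟩
    a + - (a * 1#)         ≡⟨ cong (λ t → a + - t) (*-identityʳ a) ⟩
    a + - a                ≡⟨ -‿inverseʳ a ⟩
    0#                     ∎
    where open ≡-Reasoning

  add-sub : ∀ a w l → (a * w + l) + (- a) * w ≡ l
  add-sub a w l = trans (cong ((a * w + l) +_) (sym (-‿distribˡ-* a w))) (xyx⁻¹≈y (a * w) l)

  sub-add : ∀ x a w → x ≡ a * w + (x + (- a) * w)
  sub-add x a w = sym (begin
    a * w + (x + (- a) * w)  ≡⟨ sym (+-assoc (a * w) x ((- a) * w)) ⟩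
    (a * w + x) + (- a) * w  ≡⟨ add-sub a w x ⟩
    x                        ∎)
    where open ≡-Reasoning

  module _ (n : ℕ) where
    open QMat 𝔽 n

    private module ≈ᵥ = Setoid (Fin n →-setoid F)

    span-inc : ∀ {ℓ} {P : V → Set ℓ} {v} → P v → mem (span P) v
    span-inc {v = v} Pv = (1# , v) ∷ [] , Pv ∷ [] , λ i → sym (trans (+-identityʳ (1# * v i)) (*-identityˡ (v i)))

    span-min : ∀ {ℓ ℓ'} {P : V → Set ℓ} (A : Subspace ℓ') → (∀ v → P v → mem A v) → span P ⊆ A
    span-min {P = P} A P⊆A v (cs , Pcs , v≈) = mem-resp A (≈ᵥ.sym v≈) (eval-mem cs Pcs)
      where
      eval-mem : ∀ cs → All (λ p → P (proj₂ p)) cs → mem A (eval cs)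
      eval-mem []             []          = mem-0 A
      eval-mem ((c , w) ∷ cs) (Pw ∷ Pcs) = mem-+ A (mem-· A c (P⊆A w Pw)) (eval-mem cs Pcs)

    span-generator-∉ : ∀ {ℓ ℓ'} {P : V → Set ℓ} {B : Subspace ℓ'} → Decidable (mem B) →
                       ∀ {v} → mem (span P) v → ¬ mem B v → ∃ λ w → P w × ¬ mem B w
    span-generator-∉ {P = P} {B} B? (cs , Pcs , v≈) v∉B = search cs Pcs (λ ∈B → v∉B (mem-resp B (≈ᵥ.sym v≈) ∈B))
      where
      search : ∀ cs → All (λ p → P (proj₂ p)) cs → ¬ mem B (eval cs) → ∃ λ w → P w × ¬ mem B w
      search []             []          ∉B = ⊥-elim (∉B (mem-0 B))
      search ((c , w) ∷ cs) (Pw ∷ Pcs) ∉B with B? w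
      ... | no w∉B = w , Pw , w∉B
      ... | yes w∈B = search cs Pcs (λ ∈B → ∉B (mem-+ B (mem-· B c w∈B) ∈B))

    ⊆-refl : ∀ {ℓ} (A : Subspace ℓ) → A ⊆ A
    ⊆-refl A v v∈A = v∈A

    ⊕-inl : ∀ {ℓ} (A B : Subspace ℓ) → A ⊆ (A ⊕ B)
    ⊕-inl A B v v∈A = span-inc (inj₁ v∈A)

    ⊕-inr : ∀ {ℓ} (A B : Subspace ℓ) → B ⊆ (A ⊕ B)
    ⊕-inr A B v v∈B = span-inc (inj₂ v∈B)

    ⊕-lub : ∀ {ℓ ℓ'} (A B : Subspace ℓ) (C : Subspace ℓ') → A ⊆ C → B ⊆ C → (A ⊕ B) ⊆ C
    ⊕-lub A B C A⊆C B⊆C = span-min C (λ { v (inj₁ v∈A) → A⊆C v v∈A ; v (inj₂ v∈B) → B⊆C v v∈B })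

    ⊕-mono : ∀ {ℓ} (A A' B B' : Subspace ℓ) → A ⊆ A' → B ⊆ B' → (A ⊕ B) ⊆ (A' ⊕ B')
    ⊕-mono A A' B B' A⊆A' B⊆B' =
      ⊕-lub A B (A' ⊕ B') (λ v v∈A → ⊕-inl A' B' v (A⊆A' v v∈A)) (λ v v∈B → ⊕-inr A' B' v (B⊆B' v v∈B))

    ⟨⟩-min : ∀ {ℓ} {A : Subspace ℓ} {u} → mem A u → ⟨ u ⟩ ⊆ A
    ⟨⟩-min {A = A} u∈A = span-min A (λ { _ refl → u∈A })

    spanOf : List V → Subspace 0ℓ
    spanOf ws = span (_∈ ws)

    ¬¬-decidable : ∀ (A : Subspace 0ℓ) → DoubleNegation (Decidable (mem A))
    ¬¬-decidable A = ¬¬-∀-enumerated (Fin n →-setoid F) (allFunctions-complete n)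
                       (λ u≈v → map′ (mem-resp A u≈v) (mem-resp A (≈ᵥ.sym u≈v))) (λ _ → ¬¬-excluded-middle)

    lc-pointwise : ∀ {k} (c : Fin k → F) (b : Fin k → V) i → lc c b i ≡ sum (λ j → c j * b j i)
    lc-pointwise {zero}  c b i = refl
    lc-pointwise {suc k} c b i = cong (c fz * b fz i +_) (lc-pointwise (tail c) (tail b) i)

    lc-cong : ∀ {k} {c c' : Fin k → F} {b b' : Fin k → V} → c ≗ c' → (∀ j → b j ≈ᵥ b' j) → lc c b ≈ᵥ lc c' b'
    lc-cong {k} {c} {c'} {b} {b'} c≗c' b≈b' i = begin
      lc c b i                    ≡⟨ lc-pointwise c b i ⟩
      sum (λ j → c j * b j i)     ≡⟨ sum-cong-≗ {k} (λ j → cong₂ _*_ (c≗c' j) (b≈b' j i)) ⟩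
      sum (λ j → c' j * b' j i)   ≡⟨ lc-pointwise c' b' i ⟨
      lc c' b' i                  ∎
      where open ≡-Reasoning

    lc-zeroˡ : ∀ {k} (b : Fin k → V) → lc (λ _ → 0#) b ≈ᵥ 0ᵥ
    lc-zeroˡ {k} b i = begin
      lc (λ _ → 0#) b i           ≡⟨ lc-pointwise (λ _ → 0#) b i ⟩
      sum (λ j → 0# * b j i)      ≡⟨ sum-cong-≗ {k} (λ j → zeroˡ (b j i)) ⟩
      sum {k} (λ _ → 0#)          ≡⟨ sum-replicate-zero k ⟩
      0#                          ∎
      where open ≡-Reasoning

    lc-+ˡ : ∀ {k} (c d : Fin k → F) (b : Fin k → V) → lc (λ j → c j + d j) b ≈ᵥ (lc c b +ᵥ lc d b)
    lc-+ˡ {k} c d b i = begin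
      lc (λ j → c j + d j) b i                              ≡⟨ lc-pointwise _ b i ⟩
      sum (λ j → (c j + d j) * b j i)                       ≡⟨ sum-cong-≗ {k} (λ j → distribʳ (b j i) (c j) (d j)) ⟩
      sum (λ j → c j * b j i + d j * b j i)                 ≡⟨ ∑-distrib-+ (λ j → c j * b j i) (λ j → d j * b j i) ⟩
      sum (λ j → c j * b j i) + sum (λ j → d j * b j i)     ≡⟨ cong₂ _+_ (lc-pointwise c b i) (lc-pointwise d b i) ⟨
      lc c b i + lc d b i                                   ∎
      where open ≡-Reasoning

    lc-+ʳ : ∀ {k} (c : Fin k → F) (u v : Fin k → V) → lc c (λ j → u j +ᵥ v j) ≈ᵥ (lc c u +ᵥ lc c v)
    lc-+ʳ {k} c u v i = begin
      lc c (λ j → u j +ᵥ v j) i                             ≡⟨ lc-pointwise c _ i ⟩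
      sum (λ j → c j * (u j i + v j i))                     ≡⟨ sum-cong-≗ {k} (λ j → distribˡ (c j) (u j i) (v j i)) ⟩
      sum (λ j → c j * u j i + c j * v j i)                 ≡⟨ ∑-distrib-+ (λ j → c j * u j i) (λ j → c j * v j i) ⟩
      sum (λ j → c j * u j i) + sum (λ j → c j * v j i)     ≡⟨ cong₂ _+_ (lc-pointwise c u i) (lc-pointwise c v i) ⟨
      lc c u i + lc c v i                                   ∎
      where open ≡-Reasoning

    lc-*ˡ : ∀ {k} a (c : Fin k → F) (b : Fin k → V) → lc (λ j → a * c j) b ≈ᵥ (a ·ᵥ lc c b)
    lc-*ˡ {k} a c b i = begin
      lc (λ j → a * c j) b i              ≡⟨ lc-pointwise _ b i ⟩
      sum (λ j → (a * c j) * b j i)       ≡⟨ sum-cong-≗ {k} (λ j → *-assoc a (c j) (b j i)) ⟩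
      sum (λ j → a * (c j * b j i))       ≡⟨ *-distribˡ-sum a (λ j → c j * b j i) ⟨
      a * sum (λ j → c j * b j i)         ≡⟨ cong (a *_) (lc-pointwise c b i) ⟨
      a * lc c b i                        ∎
      where open ≡-Reasoning

    lc-scaled : ∀ {k} (c τ : Fin k → F) y → lc c (λ j → τ j ·ᵥ y) ≈ᵥ (sum (λ j → c j * τ j) ·ᵥ y)
    lc-scaled {k} c τ y i = begin
      lc c (λ j → τ j ·ᵥ y) i             ≡⟨ lc-pointwise c _ i ⟩
      sum (λ j → c j * (τ j * y i))       ≡⟨ sum-cong-≗ {k} (λ j → *-assoc (c j) (τ j) (y i)) ⟨
      sum (λ j → (c j * τ j) * y i)       ≡⟨ *-distribʳ-sum (y i) (λ j → c j * τ j) ⟨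
      sum (λ j → c j * τ j) * y i         ∎
      where open ≡-Reasoning

    lc-removeAt : ∀ {k} (c : Fin (suc k) → F) (b : Fin (suc k) → V) p →
                  lc c b ≈ᵥ ((c p ·ᵥ b p) +ᵥ lc (removeAt c p) (removeAt b p))
    lc-removeAt c b p i = begin
      lc c b i                                                    ≡⟨ lc-pointwise c b i ⟩
      sum (λ j → c j * b j i)                                     ≡⟨ sum-remove {i = p} (λ j → c j * b j i) ⟩
      c p * b p i + sum (λ j → c (punchIn p j) * b (punchIn p j) i)
        ≡⟨ cong (c p * b p i +_) (lc-pointwise (removeAt c p) (removeAt b p) i) ⟨
      c p * b p i + lc (removeAt c p) (removeAt b p) i            ∎
      where open ≡-Reasoning

    lc-tail : ∀ {k} (c : Fin (suc k) → F) (b : Fin (suc k) → V) → c fz ≡ 0# → lc c b ≈ᵥ lc (tail c) (tail b)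
    lc-tail c b c₀≡0 i = begin
      c fz * b fz i + lc (tail c) (tail b) i   ≡⟨ cong (λ t → t * b fz i + lc (tail c) (tail b) i) c₀≡0 ⟩
      0# * b fz i + lc (tail c) (tail b) i     ≡⟨ cong (_+ lc (tail c) (tail b) i) (zeroˡ (b fz i)) ⟩
      0# + lc (tail c) (tail b) i              ≡⟨ +-identityˡ _ ⟩
      lc (tail c) (tail b) i                   ∎
      where open ≡-Reasoning

    lc-mem : ∀ {ℓ k} (A : Subspace ℓ) (c : Fin k → F) (b : Fin k → V) → (∀ j → mem A (b j)) → mem A (lc c b)
    lc-mem {k = zero}  A c b b∈A = mem-0 A
    lc-mem {k = suc k} A c b b∈A = mem-+ A (mem-· A (c fz) (b∈A fz)) (lc-mem A (tail c) (tail b) (b∈A ∘ fs))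

    InSpan : ∀ {k} → (Fin k → V) → V → Set
    InSpan {k} b v = Σ (Fin k → F) λ c → v ≈ᵥ lc c b

    spanned-⊆ : ∀ {ℓ ℓ' k} {A : Subspace ℓ} (B : Subspace ℓ') {b : Fin k → V} →
                (∀ v → mem A v → InSpan b v) → (∀ j → mem B (b j)) → A ⊆ B
    spanned-⊆ B {b} A⊆b b∈B v v∈A = mem-resp B (≈ᵥ.sym (proj₂ (A⊆b v v∈A))) (lc-mem B _ b b∈B)

    Independent : ∀ {k} → (Fin k → V) → Set
    Independent {k} b = ∀ (c : Fin k → F) → lc c b ≈ᵥ 0ᵥ → ∀ i → c i ≡ 0#

    independent-nonzero : ∀ {k} {u : Fin (suc k) → V} → Independent u → ∀ p → ¬ (u p ≈ᵥ 0ᵥ)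
    independent-nonzero {u = u} ind p up≈0 = 0≢1 (begin
      0#      ≡⟨ ind δ lcδ≈0 p ⟨
      δ p     ≡⟨ insertAt-lookup (λ _ → 0#) p 1# ⟩
      1#      ∎)
      where
      open ≡-Reasoning
      δ = insertAt (λ _ → 0#) p 1#
      lcδ≈0 : lc δ u ≈ᵥ 0ᵥ
      lcδ≈0 i = begin
        lc δ u i                                              ≡⟨ lc-removeAt δ u p i ⟩
        δ p * u p i + lc (removeAt δ p) (removeAt u p) i
          ≡⟨ cong₂ _+_ (cong (δ p *_) (up≈0 i)) (lc-cong (insertAt-punchIn (λ _ → 0#) p 1#) (λ _ _ → refl) i) ⟩
        δ p * 0# + lc (λ _ → 0#) (removeAt u p) i
          ≡⟨ cong₂ _+_ (zeroʳ (δ p)) (lc-zeroˡ (removeAt u p) i) ⟩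
        0# + 0#                                               ≡⟨ +-identityˡ 0# ⟩
        0#                                                    ∎

    independent-eliminate : ∀ {m} {u : Fin (suc m) → V} → Independent u → ∀ p (τ : Fin m → F) →
                            Independent (λ j → u (punchIn p j) +ᵥ (τ j ·ᵥ u p))
    independent-eliminate {u = u} ind p τ d lcd≈0 j = begin
      d j                ≡⟨ insertAt-punchIn d p σ j ⟨
      D (punchIn p j)    ≡⟨ ind D lcD≈0 (punchIn p j) ⟩
      0#                 ∎
      where
      open ≡-Reasoning
      σ = sum (λ j → d j * τ j)
      D = insertAt d p σ
      lcD≈0 : lc D u ≈ᵥ 0ᵥ
      lcD≈0 i = begin
        lc D u i                                                        ≡⟨ lc-removeAt D u p i ⟩
        D p * u p i + lc (removeAt D p) (removeAt u p) i
          ≡⟨ cong₂ _+_ (cong (_* u p i) (insertAt-lookup d p σ)) (lc-cong (insertAt-punchIn d p σ) (λ _ _ → refl) i) ⟩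
        σ * u p i + lc d (removeAt u p) i
          ≡⟨ +-comm _ _ ⟩
        lc d (removeAt u p) i + σ * u p i
          ≡⟨ cong (lc d (removeAt u p) i +_) (lc-scaled d τ (u p) i) ⟨
        lc d (removeAt u p) i + lc d (λ j → τ j ·ᵥ u p) i
          ≡⟨ lc-+ʳ d (removeAt u p) (λ j → τ j ·ᵥ u p) i ⟨
        lc d (λ j → u (punchIn p j) +ᵥ (τ j ·ᵥ u p)) i
          ≡⟨ lcd≈0 i ⟩
        0#                                                              ∎

    inSpan-eliminate : ∀ {k} (e : Fin (suc k) → V) {v y α β b⁻¹} → v ≈ᵥ lc α e → y ≈ᵥ lc β e → β fz * b⁻¹ ≡ 1# →
                       InSpan (tail e) (v +ᵥ ((- (α fz * b⁻¹)) ·ᵥ y))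
    inSpan-eliminate e {v} {y} {α} {β} {b⁻¹} v≈ y≈ inv =
      tail γ , λ i → trans (v+τy≈ i) (lc-tail γ e (pivot-cancel inv) i)
      where
      open ≡-Reasoning
      τ = - (α fz * b⁻¹)
      γ = λ l → α l + τ * β l
      v+τy≈ : (v +ᵥ (τ ·ᵥ y)) ≈ᵥ lc γ e
      v+τy≈ i = begin
        v i + τ * y i                          ≡⟨ cong₂ (λ s t → s + τ * t) (v≈ i) (y≈ i) ⟩
        lc α e i + τ * lc β e i                ≡⟨ cong (lc α e i +_) (lc-*ˡ τ β e i) ⟨
        lc α e i + lc (λ l → τ * β l) e i      ≡⟨ lc-+ˡ α (λ l → τ * β l) e i ⟨
        lc γ e i                               ∎

    module _ (_≟_ : DecidableEquality F) where

      _≈ᵥ?_ : ∀ u v → Dec (u ≈ᵥ v)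
      u ≈ᵥ? v = Fin.all? (λ i → u i ≟ v i)

      inSpan? : ∀ {k} (b : Fin k → V) v → Dec (InSpan b v)
      inSpan? {k} b v = ∃?-enumerated (Fin k →-setoid F) (allFunctions-complete k)
                          (λ c≗c' v≈ → ≈ᵥ.trans v≈ (lc-cong c≗c' (λ _ → ≈ᵥ.refl))) (λ c → v ≈ᵥ? lc c b)

      independent-extend : ∀ {k} {u : Fin k → V} {y} → Independent u → ¬ InSpan u y → Independent (y ∷ᶠ u)
      independent-extend {u = u} {y} ind y∉ c lc≈0 with c fz ≟ 0#
      ... | yes c₀≡0 = λ { fz → c₀≡0 ; (fs i) → ind (tail c) (≈ᵥ.trans (≈ᵥ.sym (lc-tail c (y ∷ᶠ u) c₀≡0)) lc≈0) i }
      ... | no c₀≢0 = ⊥-elim (y∉ ((λ j → (- c₀⁻¹) * c (fs j)) , y≈))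
        where
        c₀⁻¹ = proj₁ (inverse (c fz) c₀≢0)
        y≈ : y ≈ᵥ lc (λ j → (- c₀⁻¹) * c (fs j)) u
        y≈ i = trans (solve-for (proj₂ (inverse (c fz) c₀≢0)) (lc≈0 i)) (sym (lc-*ˡ (- c₀⁻¹) (tail c) u i))

      -- Steinitz exchange: a member of u with nonzero coefficient on e₀ is used to eliminate e₀ from the others.
      independent-size-≤ : ∀ {k m} (e : Fin k → V) (u : Fin m → V) → Independent u → (∀ p → InSpan e (u p)) → m ≤ k
      independent-size-≤ {m = zero} e u ind u∈e = z≤n
      independent-size-≤ {zero} {suc m} e u ind u∈e = ⊥-elim (independent-nonzero {u = u} ind fz (proj₂ (u∈e fz)))
      independent-size-≤ {suc k} {suc m} e u ind u∈e = step (Fin.any? (λ p → ¬? (coeff p fz ≟ 0#)))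
        where
        coeff : Fin (suc m) → Fin (suc k) → F
        coeff p = proj₁ (u∈e p)
        step : Dec (∃ λ p → ¬ (coeff p fz ≡ 0#)) → suc m ≤ suc k
        step (no no-pivot) = ℕ.m≤n⇒m≤1+n (independent-size-≤ (tail e) u ind u∈tail)
          where
          u∈tail : ∀ p → InSpan (tail e) (u p)
          u∈tail p = tail (coeff p) , ≈ᵥ.trans (proj₂ (u∈e p))
                       (lc-tail (coeff p) e (decidable-stable (coeff p fz ≟ 0#) (λ ≢0 → no-pivot (p , ≢0))))
        step (yes (p , pivot≢0)) =
          s≤s (independent-size-≤ (tail e) _ (independent-eliminate {u = u} ind p τ) eliminated∈tail)
          where
          pivot⁻¹ = inverse (coeff p fz) pivot≢0
          τ = λ j → - (coeff (punchIn p j) fz * proj₁ pivot⁻¹)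
          eliminated∈tail : ∀ j → InSpan (tail e) (u (punchIn p j) +ᵥ (τ j ·ᵥ u p))
          eliminated∈tail j = inSpan-eliminate e {α = coeff (punchIn p j)} {coeff p}
                                (proj₂ (u∈e (punchIn p j))) (proj₂ (u∈e p)) (proj₂ pivot⁻¹)

      independent⇒spanning : ∀ {ℓ k} {A : Subspace ℓ} → HasDim A k → (u : Fin k → V) → Independent u →
                             (∀ i → mem A (u i)) → ∀ v → mem A v → InSpan u v
      independent⇒spanning {k = k} (e , _ , _ , A⊆e) u ind u∈A v v∈A with inSpan? u v
      ... | yes v∈u = v∈u
      ... | no v∉u  = ⊥-elim (ℕ.n≮n k (independent-size-≤ e (v ∷ᶠ u) (independent-extend ind v∉u) v∷u⊆e))
        where
        v∷u⊆e : ∀ i → InSpan e ((v ∷ᶠ u) i)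
        v∷u⊆e fz     = A⊆e v v∈A
        v∷u⊆e (fs i) = A⊆e (u i) (u∈A i)

      module _ {ℓ} (S : Subspace ℓ) (S? : Decidable (mem S)) {k} (e : Fin k → V) (S⊆e : ∀ v → mem S v → InSpan e v) where

        private
          extension? : ∀ {m} (u : Fin m → V) → Dec (∃ λ v → mem S v × ¬ InSpan u v)
          extension? u = ∃?-enumerated (Fin n →-setoid F) (allFunctions-complete n) resp
                           (λ v → S? v ×-dec ¬? (inSpan? u v))
            where
            resp : ∀ {v w} → v ≈ᵥ w → mem S v × ¬ InSpan u v → mem S w × ¬ InSpan u w
            resp v≈w (v∈S , v∉u) = mem-resp S v≈w v∈S , λ (c , w≈) → v∉u (c , ≈ᵥ.trans v≈w w≈)

          -- Since an independent family inside span e has at most k members, fuel k is never exhausted.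
          grow : ∀ fuel {m} (u : Fin m → V) → Independent u → (∀ i → mem S (u i)) → k ≤ m ℕ.+ fuel → ∃ (HasDim S)
          grow fuel {m} u ind u∈S bound with extension? u
          ... | no maximal =
            m , u , u∈S , ind , λ v v∈S → decidable-stable (inSpan? u v) (λ v∉u → maximal (v , v∈S , v∉u))
          ... | yes (v , v∈S , v∉u) with fuel
          ...   | zero = ⊥-elim (ℕ.<⇒≱ (independent-size-≤ e (v ∷ᶠ u) (independent-extend ind v∉u) v∷u⊆e)
                                       (subst (k ≤_) (ℕ.+-identityʳ m) bound))
            where
            v∷u⊆e : ∀ i → InSpan e ((v ∷ᶠ u) i)
            v∷u⊆e fz     = S⊆e v v∈S
            v∷u⊆e (fs i) = S⊆e (u i) (u∈S i)
          ...   | suc fuel = grow fuel (v ∷ᶠ u) (independent-extend ind v∉u) (λ { fz → v∈S ; (fs i) → u∈S i })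
                                  (subst (k ≤_) (ℕ.+-suc m fuel) bound)

        dimension : ∃ (HasDim S)
        dimension = grow k (λ ()) (λ _ _ ()) (λ ()) ℕ.≤-refl

      dim⇒decidable : ∀ {ℓ k} {A : Subspace ℓ} → HasDim A k → Decidable (mem A)
      dim⇒decidable {A = A} (b , b∈A , _ , A⊆b) v =
        map′ (λ (c , v≈) → mem-resp A (≈ᵥ.sym v≈) (lc-mem A c b b∈A)) (A⊆b v) (inSpan? b v)

      hyperplane-decompose : ∀ {ℓ} {H A : Subspace ℓ} {w} → Codim1 H A → mem A w → ¬ mem H w →
                             ∀ v → mem A v → ∃ λ a → mem H (v +ᵥ ((- a) ·ᵥ w))
      hyperplane-decompose {H = H} {A} {w} (H⊆A , _ , (d , d∈H , d-indep , _) , dimA) w∈A w∉H v v∈A =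
        decompose (independent⇒spanning {A = A} dimA (w ∷ᶠ d) (independent-extend d-indep w∉d) w∷d∈A v v∈A)
        where
        w∉d : ¬ InSpan d w
        w∉d (c , w≈) = w∉H (mem-resp H (≈ᵥ.sym w≈) (lc-mem H c d d∈H))
        w∷d∈A : ∀ i → mem A ((w ∷ᶠ d) i)
        w∷d∈A fz     = w∈A
        w∷d∈A (fs i) = H⊆A (d i) (d∈H i)
        decompose : InSpan (w ∷ᶠ d) v → ∃ λ a → mem H (v +ᵥ ((- a) ·ᵥ w))
        decompose (c , v≈) =
          c fz , mem-resp H (λ i → sym (trans (cong (_+ (- c fz) * w i) (v≈ i)) (add-sub (c fz) (w i) _)))
                            (lc-mem H (tail c) d d∈H)

      hyperplane-⊕ : ∀ {ℓ} {H A L : Subspace ℓ} {w} → Codim1 H A → mem A w → ¬ mem H w → mem L w → A ⊆ (H ⊕ L)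
      hyperplane-⊕ {H = H} {A} {L} {w} H⋖A w∈A w∉H w∈L v v∈A =
        split (hyperplane-decompose {H = H} {A} H⋖A w∈A w∉H v v∈A)
        where
        split : ∃ (λ a → mem H (v +ᵥ ((- a) ·ᵥ w))) → mem (H ⊕ L) v
        split (a , rest∈H) = mem-resp (H ⊕ L) (λ i → sym (sub-add (v i) a (w i)))
                               (mem-+ (H ⊕ L) (⊕-inr H L _ (mem-· L a w∈L)) (⊕-inl H L (v +ᵥ ((- a) ·ᵥ w)) rest∈H))

      codim1-∩ : ∀ {B C X : Subspace 0ℓ} {w} → Decidable (mem X) → Codim1 B C → X ⊆ C → mem X w → ¬ mem B w →
                 Codim1 (B ∩ X) X
      codim1-∩ {B} {C} {X} {w} X? B⋖C@(_ , _ , dimB@(b , _ , _ , B⊆b) , _) X⊆C w∈X w∉B =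
        extend (dimension (B ∩ X) (λ v → dim⇒decidable {A = B} dimB v ×-dec X? v) b (λ v v∈B∩X → B⊆b v (proj₁ v∈B∩X)))
        where
        extend : ∃ (HasDim (B ∩ X)) → Codim1 (B ∩ X) X
        extend (m , dimB∩X@(d , d∈B∩X , d-indep , B∩X⊆d)) =
          (λ v → proj₂) , m , dimB∩X , w ∷ᶠ d , w∷d∈X , independent-extend d-indep w∉d , X⊆w∷d
          where
          w∉d : ¬ InSpan d w
          w∉d (c , w≈) = w∉B (proj₁ (mem-resp (B ∩ X) (≈ᵥ.sym w≈) (lc-mem (B ∩ X) c d d∈B∩X)))
          w∷d∈X : ∀ i → mem X ((w ∷ᶠ d) i)
          w∷d∈X fz     = w∈X
          w∷d∈X (fs i) = proj₂ (d∈B∩X i)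
          X⊆w∷d : ∀ v → mem X v → InSpan (w ∷ᶠ d) v
          X⊆w∷d v v∈X = coordinates (hyperplane-decompose {H = B} {C} B⋖C (X⊆C w w∈X) w∉B v (X⊆C v v∈X))
            where
            coordinates : ∃ (λ a → mem B (v +ᵥ ((- a) ·ᵥ w))) → InSpan (w ∷ᶠ d) v
            coordinates (a , rest∈B) with B∩X⊆d _ (rest∈B , mem-+ X v∈X (mem-· X (- a) w∈X))
            ... | (c , rest≈) = a ∷ᶠ c , λ i → trans (sub-add (v i) a (w i)) (cong (a * w i +_) (rest≈ i))

    module _ (M : QMatroid) where
      open QMatroid M

      Redundant : Subspace 0ℓ → V → Set
      Redundant X u = r (X ⊕ ⟨ u ⟩) ≡ r X

      redundant-resp : ∀ X {u w} → u ≈ᵥ w → Redundant X u → Redundant X w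
      redundant-resp X u≈w = trans (r-resp (⊕⟨⟩-⊆ u≈w , ⊕⟨⟩-⊆ (≈ᵥ.sym u≈w)))
        where
        ⊕⟨⟩-⊆ : ∀ {u w} → u ≈ᵥ w → (X ⊕ ⟨ w ⟩) ⊆ (X ⊕ ⟨ u ⟩)
        ⊕⟨⟩-⊆ {u} {w} u≈w = ⊕-lub X ⟨ w ⟩ (X ⊕ ⟨ u ⟩) (⊕-inl X ⟨ u ⟩)
                              (⟨⟩-min {A = X ⊕ ⟨ u ⟩} (⊕-inr X ⟨ u ⟩ w (mem-resp ⟨ u ⟩ u≈w (span-inc refl))))

      ⊕-rank-≤ : ∀ P Q → r Q ≤ r (P ∩ Q) → r (P ⊕ Q) ≤ r P
      ⊕-rank-≤ P Q rQ≤ = ℕ.+-cancelʳ-≤ (r (P ∩ Q)) (r (P ⊕ Q)) (r P)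
                           (ℕ.≤-trans (R3 P Q) (ℕ.+-monoʳ-≤ (r P) rQ≤))

      rank-absorb : ∀ {X P Q} → X ⊆ P → X ⊆ Q → r Q ≤ r X → r (P ⊕ Q) ≤ r P
      rank-absorb {X} {P} {Q} X⊆P X⊆Q rQ≤rX = ⊕-rank-≤ P Q (ℕ.≤-trans rQ≤rX (R2 {X} {P ∩ Q} X⊆P∩Q))
        where
        X⊆P∩Q : X ⊆ (P ∩ Q)
        X⊆P∩Q v v∈X = X⊆P v v∈X , X⊆Q v v∈X

      span-redundant-≤ : ∀ {X Y} → X ⊆ Y → (ws : List V) → All (Redundant X) ws → r (Y ⊕ spanOf ws) ≤ r Y
      span-redundant-≤ {X} {Y} X⊆Y [] [] = R2 (⊕-lub Y (spanOf []) Y (⊆-refl Y) (span-min Y (λ _ ())))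
      span-redundant-≤ {X} {Y} X⊆Y (w ∷ ws) (red ∷ reds) = begin
        r (Y ⊕ spanOf (w ∷ ws))     ≤⟨ R2 ⊆P⊕X⟨w⟩ ⟩
        r (P ⊕ (X ⊕ ⟨ w ⟩))         ≤⟨ rank-absorb X⊆P (⊕-inl X ⟨ w ⟩) (ℕ.≤-reflexive red) ⟩
        r P                         ≤⟨ span-redundant-≤ X⊆Y ws reds ⟩
        r Y                         ∎
        where
        open ℕ.≤-Reasoning
        P = Y ⊕ spanOf ws
        X⊆P : X ⊆ P
        X⊆P v v∈X = ⊕-inl Y (spanOf ws) v (X⊆Y v v∈X)
        ⊆P⊕X⟨w⟩ : (Y ⊕ spanOf (w ∷ ws)) ⊆ (P ⊕ (X ⊕ ⟨ w ⟩))
        ⊆P⊕X⟨w⟩ = ⊕-lub Y (spanOf (w ∷ ws)) (P ⊕ (X ⊕ ⟨ w ⟩))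
          (λ v v∈Y → ⊕-inl P (X ⊕ ⟨ w ⟩) v (⊕-inl Y (spanOf ws) v v∈Y))
          (span-min (P ⊕ (X ⊕ ⟨ w ⟩)) λ
            { v (here refl)  → ⊕-inr P (X ⊕ ⟨ w ⟩) v (⊕-inr X ⟨ w ⟩ v (span-inc refl))
            ; v (there v∈ws) → ⊕-inl P (X ⊕ ⟨ w ⟩) v (⊕-inr Y (spanOf ws) v (span-inc v∈ws)) })

      cl-rank-≤ : ∀ {X Y} → X ⊆ Y → r (cl M X) ≤ r Y
      cl-rank-≤ {X} {Y} X⊆Y = begin
        r (cl M X)                  ≤⟨ R2 (⊕-inr Y (cl M X)) ⟩
        r (Y ⊕ cl M X)              ≤⟨ R2 (⊕-mono Y Y (cl M X) (spanOf redundants) (⊆-refl Y) cl⊆) ⟩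
        r (Y ⊕ spanOf redundants)   ≤⟨ span-redundant-≤ X⊆Y redundants (all-filter redundant? (allFunctions n)) ⟩
        r Y                         ∎
        where
        open ℕ.≤-Reasoning
        redundant? : Decidable (Redundant X)
        redundant? u = r (X ⊕ ⟨ u ⟩) ℕ.≟ r X
        redundants = filter redundant? (allFunctions n)
        representative : ∀ {u} → Redundant X u → ∃ (λ w → w ∈ allFunctions n × u ≈ᵥ w) → mem (spanOf redundants) u
        representative red (w , w∈ , u≈w) = mem-resp (spanOf redundants) (≈ᵥ.sym u≈w)
                                              (span-inc (∈-filter⁺ redundant? w∈ (redundant-resp X u≈w red)))
        cl⊆ : cl M X ⊆ spanOf redundants
        cl⊆ = span-min (spanOf redundants) λ u (_ , red) → representative red (find (allFunctions-complete n u))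

      module _ (_≟_ : DecidableEquality F) where

        ⊆-cl : ∀ X → X ⊆ cl M X
        ⊆-cl X v v∈X with (_≈ᵥ?_ _≟_) v 0ᵥ
        ... | yes v≈0 = mem-resp (cl M X) (≈ᵥ.sym v≈0) (mem-0 (cl M X))
        ... | no v≉0  = span-inc (v≉0 , r-resp (⊕-lub X ⟨ v ⟩ X (⊆-refl X) (⟨⟩-min {A = X} v∈X) , ⊕-inl X ⟨ v ⟩))

        cl-flat : ∀ X → IsFlat M (cl M X)
        cl-flat X x (b , b∈x , b-indep , x⊆b) x⊈C with r (cl M X) ℕ.<? r (cl M X ⊕ x)
        ... | yes r-grows = r-grows
        ... | no r-stays  = ⊥-elim (x⊈C (spanned-⊆ {A = x} (cl M X) {b} x⊆b λ
                              { fz → span-inc (independent-nonzero {u = b} b-indep fz , b₀-redundant) }))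
          where
          open ℕ.≤-Reasoning
          b₀-redundant : Redundant X (b fz)
          b₀-redundant = ℕ.≤-antisym (begin
            r (X ⊕ ⟨ b fz ⟩)   ≤⟨ R2 (⊕-mono X (cl M X) ⟨ b fz ⟩ x (⊆-cl X) (⟨⟩-min {A = x} (b∈x fz))) ⟩
            r (cl M X ⊕ x)     ≤⟨ ℕ.≮⇒≥ r-stays ⟩
            r (cl M X)         ≤⟨ cl-rank-≤ (⊆-refl X) ⟩
            r X                ∎)
            (R2 (⊕-inl X ⟨ b fz ⟩))

        cl-cyclic : ∀ X → Decidable (mem X) → CyclicallyClosed M X → IsCyclic M (cl M X)
        cl-cyclic X X? (_ , X⊆cycX) B B⋖C@(B⊆C , _ , dimB , _) = ℕ.≤-antisym (R2 B⊆C) rC≤rB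
          where
          open ℕ.≤-Reasoning
          B? : Decidable (mem B)
          B? = dim⇒decidable _≟_ {A = B} dimB

          X∖B-resp : ∀ {u v} → u ≈ᵥ v → mem X u × ¬ mem B u → mem X v × ¬ mem B v
          X∖B-resp u≈v (u∈X , u∉B) = mem-resp X u≈v u∈X , λ v∈B → u∉B (mem-resp B (≈ᵥ.sym u≈v) v∈B)

          via-generator : ∃ (λ w → mem (cyc M X) w × ¬ mem B w) → r (cl M X) ≤ r B
          via-generator (v , v∈cycX , v∉B) with span-generator-∉ {B = B} B? v∈cycX v∉B
          ... | (w , (line , _ , line⊆X , w∈line , line-stable) , w∉B) = begin
            r (cl M X)   ≤⟨ cl-rank-≤ (⊕-inr B X) ⟩
            r (B ⊕ X)    ≤⟨ ⊕-rank-≤ B X rX≤rB∩X ⟩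
            r B          ∎
            where
            B∩X⋖X : Codim1 (B ∩ X) X
            B∩X⋖X = codim1-∩ _≟_ {B} {cl M X} {X} X? B⋖C (⊆-cl X) (line⊆X w w∈line) w∉B
            rX≤rB∩X : r X ≤ r (B ∩ X)
            rX≤rB∩X = begin
              r X                  ≤⟨ R2 (hyperplane-⊕ _≟_ {H = B ∩ X} {X} {line} B∩X⋖X
                                            (line⊆X w w∈line) (w∉B ∘ proj₁) w∈line) ⟩
              r ((B ∩ X) ⊕ line)   ≡⟨ line-stable (B ∩ X) B∩X⋖X ⟩
              r (B ∩ X)            ∎

          rC≤rB : r (cl M X) ≤ r B
          rC≤rB with ∃?-enumerated (Fin n →-setoid F) (allFunctions-complete n) X∖B-resp
                       (λ v → X? v ×-dec ¬? (B? v))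
          ... | no X⊆B = cl-rank-≤ (λ v v∈X → decidable-stable (B? v) (λ v∉B → X⊆B (v , v∈X , v∉B)))
          ... | yes (v , v∈X , v∉B) = via-generator (v , X⊆cycX v v∈X , v∉B)

lemma2p20 : (𝔽 : FiniteField) (n : ℕ) (M : QMat.QMatroid 𝔽 n) (X : QMat.Subspace 𝔽 n 0ℓ)
    → QMat.CyclicallyClosed 𝔽 n M X
    → QMat.IsCyclicFlat 𝔽 n M (QMat.cl 𝔽 n M X)
lemma2p20 𝔽 n M X cc = cyclic , flat
  where
  open QMat 𝔽 n
  open QMatroid M using (r)
  open RawMonad (¬¬-Monad {0ℓ}) using (_<$>_; _⊛_)

  -- Equality in 𝔽 and membership in X are decidable only under ¬¬, which suffices because both
  -- conclusions are decidable statements about ranks.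

  cyclic : IsCyclic M (cl M X)
  cyclic B B⋖C = decidable-stable (r B ℕ.≟ r (cl M X))
    ((λ _≟_ X? → cl-cyclic 𝔽 n M _≟_ X X? cc B B⋖C) <$> ¬¬-decidableEquality 𝔽 ⊛ ¬¬-decidable 𝔽 n X)

  flat : IsFlat M (cl M X)
  flat x dimx x⊈C = decidable-stable (r (cl M X) ℕ.<? r (cl M X ⊕ x))
    ((λ _≟_ → cl-flat 𝔽 n M _≟_ X x dimx x⊈C) <$> ¬¬-decidableEquality 𝔽)
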